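{- Let $T$ be a complete first-order theory with monster model $\mathbb{M}$, and let $\varphi(\bar{x};\bar{y})$ be a partitioned formula which is $d$-*maximum for some $d\in\omega$. Then $\varphi(\bar{x};\bar{y})$ is stable if and only if there is $n\in\omega$ such that for every $c\in\mathcal{C}_{\varphi^*}(\mathbb{M})$, $\mathcal{C}_{\varphi^*}(\mathbb{M})\subseteq[M^{|\bar{y}|}]^{\le n}\Delta c$.
   Context: For a set $Y$, $[Y]^{\le n}=\{A\subseteq Y:|A|\le n\}$, and for $\mathcal{D}\subseteq 2^Y$ and $c\subseteq Y$, $\mathcal{D}\Delta c=\{f\Delta c:f\in\mathcal{D}\}$ where $\Delta$ is symmetric difference. $\varphi(\bar{x};\bar{y})$ is stable if for some $N\in\omega$ there are no $\bar{a}_1,\ldots,\bar{a}_N\in M^{|\bar{x}|}$ and $\bar{b}_1,\ldots,\bar{b}_N\in M^{|\bar{y}|}$ with $\models\varphi(\bar{a}_i;\bar{b}_j)\iff i<j$ for all $i,j$. Let $\mathcal{C}_{\varphi^*}(\mathbb{M})=\{\{\bar{b}\in M^{|\bar{y}|}:\models\varphi(\bar{a};\bar{b})\}:\bar{a}\in M^{|\bar{x}|}\}$. For $\mathcal{C}\subseteq 2^X$ and $A\subseteq X$, $\mathcal{C}(A)=\{c\cap A:c\in\mathcal{C}\}$; $\mathcal{C}$ shatters $A$ if $\mathcal{C}(A)=2^A$; VC dimension is the supremum of sizes of shattered sets; with $\Phi_d(n)=\sum_{i=0}^d\binom ni$, $\mathcal{C}$ is $d$-maximum if its VC dimension is $d$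 and $|\mathcal{C}(A)|=\Phi_d(|A|)$ for every finite $A\subseteq X$. $\varphi$ is $d$-*maximum if $\mathcal{C}_{\varphi^*}(\mathbb{M})$ is $d$-maximum. -}

module Defs where

open import Level using (Level) renaming (zero to lzero; suc to lsuc)
open import Data.Nat using (ℕ; zero; suc; _+_; _≤_)
open import Data.Nat.Combinatorics using (_C_)
open import Data.Fin using (Fin) renaming (_<_ to _<ᶠ_)
open import Data.Vec using (Vec; []; _∷_; _++_; lookup)
open import Data.List using (List; length)
open import Data.List.Membership.Propositional using (_∈_)
open import Data.Bool using (Bool; true)
open import Data.Sum using (_⊎_)
open import Data.Product using (Σ; ∃; ∃-syntax; _×_; _,_)
open import Data.Empty using (⊥)
open import Data.Unit using (⊤)
open import Relation.Nullary using (¬_)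
open import Relation.Binary.PropositionalEquality using (_≡_; _≢_)
open import Function.Bundles using (_⇔_)

record Signature : Set₁ where
  field
    Func : ℕ → Set      -- function symbols of each arity (arity 0 = constants)
    Rel  : ℕ → Set
open Signature public

-- terms and formulas with de Bruijn variables: Fin n free variables
data Term (L : Signature) (n : ℕ) : Set where
  var : Fin n → Term L n
  app : ∀ {k} → Func L k → Vec (Term L n) k → Term L n

data Formula (L : Signature) : ℕ → Set where
  falsum : ∀ {n} → Formula L n
  equal  : ∀ {n} → Term L n → Term L n → Formula L n
  rel    : ∀ {n k} → Rel L k → Vec (Term L n) k → Formula L n
  neg    : ∀ {n} → Formula L n → Formula L n
  conj   : ∀ {n} → Formula L n → Formula L n → Formula L n
  disj   : ∀ {n} → Formula L n → Formula L n → Formula L n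
  impl   : ∀ {n} → Formula L n → Formula L n → Formula L n
  all    : ∀ {n} → Formula L (suc n) → Formula L n   -- binds variable 0
  ex     : ∀ {n} → Formula L (suc n) → Formula L n   -- binds variable 0

Sentence : Signature → Set
Sentence L = Formula L 0

record Structure (L : Signature) : Set₁ where
  field
    Carrier : Set
    funI    : ∀ {k} → Func L k → Vec Carrier k → Carrier
    relI    : ∀ {k} → Rel L k → Vec Carrier k → Set
    point   : Carrier      -- domains of first-order structures are nonempty
open Structure public

module _ {L : Signature} (M : Structure L) where
  mutual
    evalT : ∀ {n} → Vec (Carrier M) n → Term L n → Carrier M
    evalT ρ (var i)    = lookup ρ i
    evalT ρ (app f ts) = funI M f (evalTs ρ ts)

    evalTs : ∀ {n k} → Vec (Carrier M) n → Vec (Term L n) k → Vec (Carrier M) k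
    evalTs ρ []       = []
    evalTs ρ (t ∷ ts) = evalT ρ t ∷ evalTs ρ ts

  Sat : ∀ {n} → Formula L n → Vec (Carrier M) n → Set
  Sat falsum       ρ = ⊥
  Sat (equal s t)  ρ = evalT ρ s ≡ evalT ρ t
  Sat (rel R ts)   ρ = relI M R (evalTs ρ ts)
  Sat (neg ψ)      ρ = ¬ Sat ψ ρ
  Sat (conj ψ χ)   ρ = Sat ψ ρ × Sat χ ρ
  Sat (disj ψ χ)   ρ = Sat ψ ρ ⊎ Sat χ ρ
  Sat (impl ψ χ)   ρ = Sat ψ ρ → Sat χ ρ
  Sat (all ψ)      ρ = ∀ a → Sat ψ (a ∷ ρ)
  Sat (ex ψ)       ρ = ∃[ a ] Sat ψ (a ∷ ρ)

Theory : Signature → Set₁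
Theory L = Sentence L → Set

_⊨T_ : ∀ {L} → Structure L → Theory L → Set
M ⊨T T = ∀ σ → T σ → Sat M σ []

_⊢_ : ∀ {L} → Theory L → Sentence L → Set₁
T ⊢ σ = ∀ (N : Structure _) → N ⊨T T → Sat N σ []

Complete : ∀ {L} → Theory L → Set₁
Complete {L} T = (∃[ N ] (N ⊨T T)) × (∀ (σ : Sentence L) → (T ⊢ σ) ⊎ (T ⊢ neg σ))

-- language L(I): L with new constants indexed by I
_[+_] : Signature → Set → Signature
L [+ I ] = record { Func = F ; Rel = Rel L }
  where
    F : ℕ → Set
    F zero    = Func L zero ⊎ I
    F (suc k) = Func L (suc k)

expand : ∀ {L} (M : Structure L) {I : Set} → (I → Carrier M) → Structure (L [+ I ])
expand {L} M {I} p = record { Carrier = Carrier M ; funI = f ; relI = relI M ; point = point M }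
  where
    f : ∀ {k} → Func (L [+ I ]) k → Vec (Carrier M) k → Carrier M
    f {zero}  (Data.Sum.inj₁ c) as = funI M c as
    f {zero}  (Data.Sum.inj₂ i) as = p i
    f {suc k} g                   as = funI M g as

-- |I| < |M|: no map from I onto M
SmallFor : ∀ {L} → Structure L → Set → Set
SmallFor M I = (f : I → Carrier M) → ∃[ m ] (∀ i → f i ≢ m)

-- a (partial) n-type over parameters p is a set of formulas of L(I)
-- in n free variables; finitely satisfiable / realized in M_p
FinSat : ∀ {L} (M : Structure L) {I : Set} (p : I → Carrier M) {n : ℕ}
         → (Formula (L [+ I ]) n → Set) → Set
FinSat M p {n} q = (Δ : List (Formula _ n)) → (∀ {ψ} → ψ ∈ Δ → q ψ) →
                   ∃[ a ] (∀ {ψ} → ψ ∈ Δ → Sat (expand M p) ψ a)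

Realized : ∀ {L} (M : Structure L) {I : Set} (p : I → Carrier M) {n : ℕ}
           → (Formula (L [+ I ]) n → Set) → Set
Realized M p {n} q = ∃[ a ] (∀ ψ → q ψ → Sat (expand M p) ψ a)

Saturated : ∀ {L} → Structure L → Set₁
Saturated {L} M = (I : Set) → SmallFor M I → (p : I → Carrier M) →
                  (n : ℕ) (q : Formula (L [+ I ]) n → Set) →
                  FinSat M p q → Realized M p q

-- monster model of T: a saturated (hence strongly homogeneous) model of T
Monster : ∀ {L} → Theory L → Structure L → Set₁
Monster T M = (M ⊨T T) × Saturated M

-- The partitioned formula φ(x̄;ȳ), |x̄| = k, |ȳ| = m: the first k
-- variables are x̄, the last m are ȳ.

module _ {L : Signature} (M : Structure L) (k m : ℕ) (φ : Formula L (k + m)) where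

  holds : Vec (Carrier M) k → Vec (Carrier M) m → Set
  holds a b = Sat M φ (a ++ b)

  Stable : Set
  Stable = ∃[ N ] ¬ (Σ (Fin N → Vec (Carrier M) k) λ as →
                      Σ (Fin N → Vec (Carrier M) m) λ bs →
                        ∀ i j → (holds (as i) (bs j) ⇔ (i <ᶠ j)))

  -- C_{φ*}(M) = { φ(ā; M^m) : ā ∈ M^k }.  A finite A ⊆ M^m of size t is a
  -- t-tuple of pairwise distinct elements; a trace c ∩ A is a bit-vector.
  Distinct : ∀ {t} {X : Set} → Vec X t → Set
  Distinct A = ∀ i j → lookup A i ≡ lookup A j → i ≡ j

  InTrace : ∀ {t} → Vec (Vec (Carrier M) m) t → Vec Bool t → Set
  InTrace A s = ∃[ a ] (∀ i → (holds a (lookup A i) ⇔ (lookup s i ≡ true)))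

  TraceCount : ∀ {t} → Vec (Vec (Carrier M) m) t → ℕ → Set
  TraceCount {t} A N = Σ (Vec (Vec Bool t) N) λ ss →
      Distinct ss × (∀ i → InTrace A (lookup ss i)) ×
      (∀ s → InTrace A s → ∃[ i ] (lookup ss i ≡ s))

  Shatters : ∀ {t} → Vec (Vec (Carrier M) m) t → Set
  Shatters A = ∀ s → InTrace A s

  VCdim : ℕ → Set
  VCdim d = (∃[ A ] (Distinct {d} A × Shatters A)) ×
            (∀ (A : Vec (Vec (Carrier M) m) (suc d)) → Distinct A → ¬ Shatters A)

Φ : ℕ → ℕ → ℕ
Φ zero    n = 1
Φ (suc d) n = Φ d n + n C suc d

module _ {L : Signature} (M : Structure L) (k m : ℕ) (φ : Formula L (k + m)) where

  DStarMaximum : ℕ → Set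
  DStarMaximum d = VCdim M k m φ d ×
    (∀ t (A : Vec (Vec (Carrier M) m) t) → Distinct M k m φ A → TraceCount M k m φ A (Φ d t))

  _xor_ : Set → Set → Set
  P xor Q = (P × ¬ Q) ⊎ (¬ P × Q)

  -- for every c ∈ C_{φ*}(M):  C_{φ*}(M) ⊆ [M^m]^{≤n} Δ c.
  -- (a finite set of size ≤ n is given by a list of length ≤ n)
  BoundedΔ : ℕ → Set
  BoundedΔ n = ∀ (a′ a : Vec (Carrier M) k) →
    ∃[ F ] (length F ≤ n ×
      (∀ b → holds M k m φ a b ⇔ ((b ∈ F) xor holds M k m φ a′ b)))

module Submission where

-- Stable ⇒ bounded.  If φ(a; M) Δ φ(a′; M) is large, it contains many points
-- on which a holds and a′ fails, or vice versa.  Colouring each (d+1)-subset of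
-- them by a pattern it does not realise (the VC dimension is d), Ramsey's theorem
-- gives h points all of whose (d+1)-subsets miss one pattern p.  Every trace on
-- these points then avoids p as a subword, and at most Φ_d(h) words do so; as φ
-- is d-maximum there are Φ_d(h) traces, so every word avoiding p is a trace.  The
-- constant words are traces, hence p is not constant and contains 10 or 01; the
-- threshold words 0ʲ1ʰ⁻ʲ (resp. 1ʲ0ʰ⁻ʲ) avoid it and give a ladder of length h.
--
-- Bounded ⇒ stable.  In a ladder of length n + 2 the points b₁, …, b_{n+1} are
-- distinct and lie in φ(a₀; M) Δ φ(a_{n+1}; M).

open import Defs
open import Level using (0ℓ)
open import Axiom.ExcludedMiddle using (ExcludedMiddle)
open import Data.Nat using (ℕ; zero; suc; _+_; _^_; _≤_; _<_; z≤n; s≤s)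
import Data.Nat.Properties as ℕ
open import Data.Nat.Combinatorics using (_C_; nC1≡n; nCk+nC[k+1]≡[n+1]C[k+1])
open import Data.Nat.Tactic.RingSolver using (solve-∀)
open import Data.Fin using (Fin; fromℕ; inject≤; join; splitAt; combine; opposite)
  renaming (zero to fzero; suc to fsuc; _<_ to _<ᶠ_)
import Data.Fin.Properties as Fin
open import Data.Bool using (Bool; true; false; not)
import Data.Bool.Properties as Bool
open import Data.Vec using (Vec; []; _∷_; head; lookup; tabulate; replicate; toList)
open import Data.Vec.Properties using (lookup∘tabulate; lookup-replicate; length-toList)
open import Data.Vec.Membership.Propositional.Properties using (∈-lookup; ∈-toList⁺; ∈-toList⁻)
import Data.Vec.Relation.Unary.Any as VecAny
import Data.Vec.Relation.Unary.Any.Properties as VecAny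
open import Data.Vec.Functional using (updateAt; foldr)
open import Data.Vec.Functional.Properties using (updateAt-updates; updateAt-minimal)
open import Data.List as List using (List; length)
open import Data.List.Membership.Propositional using (_∈_)
open import Data.List.Relation.Unary.Any using (index)
open import Data.List.Relation.Unary.Any.Properties using (lookup-index)
open import Data.Product using (Σ; _×_; _,_; proj₁; proj₂; ∃-syntax)
open import Data.Sum using (_⊎_; inj₁; inj₂; [_,_]′)
open import Data.Sum.Properties using (inj₁-injective; inj₂-injective)
open import Data.Empty using (⊥; ⊥-elim)
open import Relation.Nullary using (¬_; Dec; yes; no; does)
open import Relation.Nullary.Decidable using (decidable-stable)
open import Relation.Binary.Definitions using (tri<; tri≈; tri>)
open import Relation.Binary.PropositionalEquality
open import Relation.Binary.PropositionalEquality.Properties using (subst-injective)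
open import Function using (_∘_; const; id)
open import Function.Bundles using (_⇔_; mk⇔; Equivalence)
open Equivalence using (to; from)
import Function.Properties.Equivalence as ⇔

private
  variable
    A B : Set
    d h k m n r t x K N T : ℕ

does≡true⇔ : (a? : Dec A) → does a? ≡ true ⇔ A
does≡true⇔ (yes a) = mk⇔ (const a) (const refl)
does≡true⇔ (no ¬a) = mk⇔ (λ ()) (⊥-elim ∘ ¬a)

does≡false⇒¬ : (a? : Dec A) → does a? ≡ false → ¬ A
does≡false⇒¬ (no ¬a) _ = ¬a

xor⇒¬ : {P Q : Set} → (P × ¬ Q) ⊎ (¬ P × Q) → P → ¬ Q
xor⇒¬ (inj₁ (_ , ¬q)) _ = ¬q
xor⇒¬ (inj₂ (¬p , _)) p = ⊥-elim (¬p p)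

xor⇒ : {P Q : Set} → (P × ¬ Q) ⊎ (¬ P × Q) → ¬ P → Q
xor⇒ (inj₁ (p , _)) ¬p = ⊥-elim (¬p p)
xor⇒ (inj₂ (_ , q)) _  = q

xor-swap : {P Q R : Set} → Dec P → Dec Q →
  R ⇔ ((P × ¬ Q) ⊎ (¬ P × Q)) → P ⇔ ((R × ¬ Q) ⊎ (¬ R × Q))
xor-swap (yes p) (yes q) R⇔ = mk⇔ (const (inj₂ (¬R , q))) (const p)
  where
    ¬R : ¬ _
    ¬R r with to R⇔ r
    ... | inj₁ (_ , ¬q) = ¬q q
    ... | inj₂ (¬p , _) = ¬p p
xor-swap (yes p) (no ¬q) R⇔ = mk⇔ (const (inj₁ (from R⇔ (inj₁ (p , ¬q)) , ¬q))) (const p)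
xor-swap (no ¬p) (yes q) R⇔ = mk⇔ (⊥-elim ∘ ¬p) λ where
  (inj₁ (_ , ¬q)) → ⊥-elim (¬q q)
  (inj₂ (¬r , _)) → ⊥-elim (¬r (from R⇔ (inj₂ (¬p , q))))
xor-swap (no ¬p) (no ¬q) R⇔ = mk⇔ (⊥-elim ∘ ¬p) λ where
  (inj₁ (r , _)) → ⊥-elim ([ ¬p ∘ proj₁ , ¬q ∘ proj₂ ]′ (to R⇔ r))
  (inj₂ (_ , q)) → ⊥-elim (¬q q)

injective-members⇒≤-length : (f : Fin N → A) (xs : List A) →
  (∀ i j → f i ≡ f j → i ≡ j) → (∀ i → f i ∈ xs) → N ≤ length xs
injective-members⇒≤-length f xs f-injective f∈xs =
  Fin.injective⇒≤ {f = index ∘ f∈xs} λ {i} {j} eq →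
  f-injective i j (begin
    f i                             ≡⟨ lookup-index (f∈xs i) ⟩
    List.lookup xs (index (f∈xs i)) ≡⟨ cong (List.lookup xs) eq ⟩
    List.lookup xs (index (f∈xs j)) ≡⟨ lookup-index (f∈xs j) ⟨
    f j                             ∎)
  where open ≡-Reasoning

-- Thinnings

infix 4 _⊑_
infixr 9 _⨾_

-- m ⊑ n is an order-preserving injection Fin m → Fin n, i.e. an m-subset of an n-set.
data _⊑_ : ℕ → ℕ → Set where
  done : 0 ⊑ 0
  skip : m ⊑ n → m ⊑ suc n
  keep : m ⊑ n → suc m ⊑ suc n

_⨾_ : k ⊑ m → m ⊑ n → k ⊑ n
θ      ⨾ done   = θ
θ      ⨾ skip φ = skip (θ ⨾ φ)
skip θ ⨾ keep φ = skip (θ ⨾ φ)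
keep θ ⨾ keep φ = keep (θ ⨾ φ)

⨾-assoc : ∀ {j} (θ : j ⊑ k) (φ : k ⊑ m) (ψ : m ⊑ n) → (θ ⨾ φ) ⨾ ψ ≡ θ ⨾ (φ ⨾ ψ)
⨾-assoc θ        φ        done     = refl
⨾-assoc θ        φ        (skip ψ) = cong skip (⨾-assoc θ φ ψ)
⨾-assoc θ        (skip φ) (keep ψ) = cong skip (⨾-assoc θ φ ψ)
⨾-assoc (skip θ) (keep φ) (keep ψ) = cong skip (⨾-assoc θ φ ψ)
⨾-assoc (keep θ) (keep φ) (keep ψ) = cong keep (⨾-assoc θ φ ψ)

empty : ∀ n → 0 ⊑ n
empty zero    = done
empty (suc n) = skip (empty n)

empty-unique : (θ : 0 ⊑ n) → θ ≡ empty n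
empty-unique done     = refl
empty-unique (skip θ) = cong skip (empty-unique θ)

≤⇒⊑ : m ≤ n → m ⊑ n
≤⇒⊑ {zero}  _       = empty _
≤⇒⊑ {suc m} (s≤s p) = keep (≤⇒⊑ p)

select : m ⊑ n → Vec A n → Vec A m
select done     []       = []
select (skip θ) (x ∷ xs) = select θ xs
select (keep θ) (x ∷ xs) = x ∷ select θ xs

embed : m ⊑ n → Fin m → Fin n
embed (skip θ) i        = fsuc (embed θ i)
embed (keep θ) fzero    = fzero
embed (keep θ) (fsuc i) = fsuc (embed θ i)

single : Fin n → 1 ⊑ n
single {suc n} fzero    = keep (empty n)
single {suc n} (fsuc i) = skip (single i)

select-empty : (xs : Vec A n) → select (empty n) xs ≡ []
select-empty []       = refl
select-empty (x ∷ xs) = select-empty xs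

select-single : (i : Fin n) (xs : Vec A n) → select (single i) xs ≡ lookup xs i ∷ []
select-single fzero    (x ∷ xs) = cong (x ∷_) (select-empty xs)
select-single (fsuc i) (x ∷ xs) = select-single i xs

select-⨾ : (θ : k ⊑ m) (φ : m ⊑ n) (xs : Vec A n) → select (θ ⨾ φ) xs ≡ select θ (select φ xs)
select-⨾ θ        done     []       = refl
select-⨾ θ        (skip φ) (x ∷ xs) = select-⨾ θ φ xs
select-⨾ (skip θ) (keep φ) (x ∷ xs) = select-⨾ θ φ xs
select-⨾ (keep θ) (keep φ) (x ∷ xs) = cong (x ∷_) (select-⨾ θ φ xs)

lookup-select : (θ : m ⊑ n) (xs : Vec A n) (i : Fin m) → lookup (select θ xs) i ≡ lookup xs (embed θ i)
lookup-select (skip θ) (x ∷ xs) i        = lookup-select θ xs i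
lookup-select (keep θ) (x ∷ xs) fzero    = refl
lookup-select (keep θ) (x ∷ xs) (fsuc i) = lookup-select θ xs i

embed-injective : (θ : m ⊑ n) {i j : Fin m} → embed θ i ≡ embed θ j → i ≡ j
embed-injective (skip θ) eq = embed-injective θ (Fin.suc-injective eq)
embed-injective (keep θ) {fzero}  {fzero}  eq = refl
embed-injective (keep θ) {fsuc i} {fsuc j} eq = cong fsuc (embed-injective θ (Fin.suc-injective eq))

∀-select : (P : A → Set) (θ : m ⊑ n) (xs : Vec A n) →
  (∀ i → P (lookup xs i)) → ∀ i → P (lookup (select θ xs) i)
∀-select P θ xs Pxs i = subst P (sym (lookup-select θ xs i)) (Pxs (embed θ i))

embed-mono-< : (θ : m ⊑ n) {i j : Fin m} → i <ᶠ j → embed θ i <ᶠ embed θ j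
embed-mono-< (skip θ) i<j = s≤s (embed-mono-< θ i<j)
embed-mono-< (keep θ) {fzero}  {fsuc j} i<j       = s≤s z≤n
embed-mono-< (keep θ) {fsuc i} {fsuc j} (s≤s i<j) = s≤s (embed-mono-< θ i<j)

-- Ramsey's theorem

HomogeneousSet : (r ⊑ n → B) → ℕ → B → Set
HomogeneousSet {r} {n} col h c = Σ (h ⊑ n) λ ψ → ∀ (θ : r ⊑ h) → col (θ ⨾ ψ) ≡ c

HomogeneousSet-⨾ : (col : r ⊑ n → B) (φ : m ⊑ n) {c : B} →
  HomogeneousSet (λ θ → col (θ ⨾ φ)) h c → HomogeneousSet col h c
HomogeneousSet-⨾ col φ (ψ , hom) = ψ ⨾ φ , λ θ → trans (cong col (sym (⨾-assoc θ ψ φ))) (hom θ)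

-- T → (a c)_c ^ r in the arrow notation of Erdős and Rado.
Arrows : ℕ → (Fin K → ℕ) → ℕ → Set
Arrows {K} T a r = (col : r ⊑ T → Fin K) → ∃[ c ] HomogeneousSet col (a c) c

sum : (Fin K → ℕ) → ℕ
sum = foldr _+_ 0

lookup≤sum : (a : Fin K → ℕ) (c : Fin K) → a c ≤ sum a
lookup≤sum a fzero    = ℕ.m≤m+n _ _
lookup≤sum a (fsuc c) = ℕ.≤-trans (lookup≤sum (a ∘ fsuc) c) (ℕ.m≤n+m _ _)

sum-updateAt : (a : Fin K → ℕ) (c : Fin K) → a c ≡ suc x → sum a ≡ suc (sum (updateAt a c (const x)))
sum-updateAt a fzero    eq = cong (_+ sum (a ∘ fsuc)) eq
sum-updateAt a (fsuc c) eq =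
  trans (cong (a fzero +_) (sum-updateAt (a ∘ fsuc) c eq)) (ℕ.+-suc (a fzero) _)

ramsey-zero : (a : Fin K → ℕ) → Arrows (sum a) a 0
ramsey-zero a col = c , ≤⇒⊑ (lookup≤sum a c) , λ θ → cong col (empty-unique _)
  where c = col (empty _)

extend-by-first : (col : suc r ⊑ suc T → B) (ψ : h ⊑ T) {c : B} →
  (∀ θ → col (keep (θ ⨾ ψ)) ≡ c) →
  HomogeneousSet (λ θ → col (θ ⨾ skip ψ)) x c → HomogeneousSet col (suc x) c
extend-by-first col ψ hom (ψ′ , hom′) = keep (ψ′ ⨾ ψ) , λ where
  (skip θ) → trans (cong (col ∘ skip) (sym (⨾-assoc θ ψ′ ψ))) (hom′ θ)
  (keep θ) → trans (cong (col ∘ keep) (sym (⨾-assoc θ ψ′ ψ))) (hom (θ ⨾ ψ′))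

ramsey-step : (a sizes : Fin K → ℕ) →
  (∀ c x → a c ≡ suc x → Arrows (sizes c) (updateAt a c (const x)) (suc r)) →
  Arrows T sizes r → Arrows (suc T) a (suc r)
ramsey-step a sizes decrement link col
  with c , ψ , hom ← link (λ θ → col (keep θ))
  with a c in e
... | zero  = c , subst (λ h → HomogeneousSet col h c) (sym e) (empty _ , λ ())
... | suc x
  with c′ , inner ← decrement c x e (λ θ → col (θ ⨾ skip ψ))
  with c′ Fin.≟ c
... | yes refl = c , subst (λ h → HomogeneousSet col h c) (sym e)
  (extend-by-first col ψ hom
    (subst (λ h → HomogeneousSet (λ θ → col (θ ⨾ skip ψ)) h c) (updateAt-updates c a) inner))
... | no c′≢c = c′ , subst (λ h → HomogeneousSet col h c′) (updateAt-minimal c′ c a c′≢c)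
  (HomogeneousSet-⨾ col (skip ψ) inner)

ramsey : ∀ r (a : Fin K → ℕ) → ∃[ T ] Arrows T a r
ramsey-suc : ∀ r s (a : Fin K → ℕ) → sum a ≡ s → ∃[ T ] Arrows T a (suc r)
ramsey-decrement : ∀ r s (a : Fin K → ℕ) → sum a ≡ s →
  ∀ c → ∃[ T ] ∀ x → a c ≡ suc x → Arrows T (updateAt a c (const x)) (suc r)

ramsey zero    a = sum a , ramsey-zero a
ramsey (suc r) a = ramsey-suc r (sum a) a refl

ramsey-suc r s a sum≡s =
  let T , link = ramsey r (proj₁ ∘ ramsey-decrement r s a sum≡s)
  in suc T , ramsey-step a _ (proj₂ ∘ ramsey-decrement r s a sum≡s) link

ramsey-decrement r s a sum≡s c with a c in e
ramsey-decrement r s       a sum≡s c | zero  = 0 , λ _ ()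
ramsey-decrement r zero    a sum≡0 c | suc x = ⊥-elim (ℕ.1+n≢0 (trans (sym (sum-updateAt a c e)) sum≡0))
ramsey-decrement r (suc s) a sum≡s c | suc x =
  let T , arrows = ramsey-suc r s (updateAt a c (const x))
                     (ℕ.suc-injective (trans (sym (sum-updateAt a c e)) sum≡s))
  in T , λ { _ refl → arrows }

bit : Bool → Fin 2
bit false = fzero
bit true  = fsuc fzero

bit-injective : (b b′ : Bool) → bit b ≡ bit b′ → b ≡ b′
bit-injective false false _ = refl
bit-injective true  true  _ = refl

bits : Vec Bool n → Fin (2 ^ n)
bits []      = fzero
bits (b ∷ w) = combine (bit b) (bits w)

bits-injective : (w w′ : Vec Bool n) → bits w ≡ bits w′ → w ≡ w′
bits-injective []      []        _  = refl
bits-injective (b ∷ w) (b′ ∷ w′) eq = cong₂ _∷_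
  (bit-injective b b′ (Fin.combine-injectiveˡ (bit b) (bits w) (bit b′) (bits w′) eq))
  (bits-injective w w′ (Fin.combine-injectiveʳ (bit b) (bits w) (bit b′) (bits w′) eq))

monochromatic-subsequence : ∀ h → ∃[ T ] ∀ {P : A → Set} → (∀ x → Dec (P x)) → (xs : Vec A T) →
  Σ (h ⊑ T) λ ψ → (∀ i → P (lookup (select ψ xs) i)) ⊎ (∀ i → ¬ P (lookup (select ψ xs) i))
monochromatic-subsequence {A = A} h =
  proj₁ R , λ {P} P? xs → monochromatic P P? xs (proj₂ R (colour P? xs))
  where
    R = ramsey {K = 2} 1 (const h)

    colour : {P : A → Set} → (∀ x → Dec (P x)) → Vec A (proj₁ R) → 1 ⊑ proj₁ R → Fin 2
    colour P? xs θ = bit (does (P? (head (select θ xs))))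

    monochromatic : (P : A → Set) (P? : ∀ x → Dec (P x)) (xs : Vec A (proj₁ R)) →
      ∃[ c ] HomogeneousSet (colour P? xs) h c →
      Σ (h ⊑ proj₁ R) λ ψ →
        (∀ i → P (lookup (select ψ xs) i)) ⊎ (∀ i → ¬ P (lookup (select ψ xs) i))
    monochromatic P P? xs (c , ψ , homogeneous) = ψ , decide c λ i →
      trans (cong (bit ∘ does ∘ P?) (sym (head-select i))) (homogeneous (single i))
      where
        head-select : ∀ i → head (select (single i ⨾ ψ) xs) ≡ lookup (select ψ xs) i
        head-select i = cong head (trans (select-⨾ (single i) ψ xs) (select-single i (select ψ xs)))

        decide : ∀ c → (∀ i → bit (does (P? (lookup (select ψ xs) i))) ≡ c) →
          (∀ i → P (lookup (select ψ xs) i)) ⊎ (∀ i → ¬ P (lookup (select ψ xs) i))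
        decide fzero        colour≡ = inj₂ λ i →
          does≡false⇒¬ (P? _) (bit-injective _ false (colour≡ i))
        decide (fsuc fzero) colour≡ = inj₁ λ i →
          to (does≡true⇔ (P? _)) (bit-injective _ true (colour≡ i))

-- Words avoiding a pattern

infix 4 _≼_

_≼_ : Vec A m → Vec A n → Set
_≼_ {m = m} {n = n} p w = Σ (m ⊑ n) λ θ → select θ w ≡ p

≼-trans : {p : Vec A k} {q : Vec A m} {w : Vec A n} → p ≼ q → q ≼ w → p ≼ w
≼-trans {w = w} (θ , refl) (φ , refl) = θ ⨾ φ , select-⨾ θ φ w

≼-skip : {p : Vec A m} {w : Vec A n} {x : A} → p ≼ w → p ≼ x ∷ w
≼-skip (θ , eq) = skip θ , eq

≼-keep : {p : Vec A m} {w : Vec A n} {x : A} → p ≼ w → x ∷ p ≼ x ∷ w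
≼-keep (θ , eq) = keep θ , cong (_ ∷_) eq

head-≼ : (x : A) (w : Vec A n) → x ∷ [] ≼ x ∷ w
head-≼ x w = single fzero , select-single fzero (x ∷ w)

Φ-zero : ∀ d → Φ d 0 ≡ 1
Φ-zero zero    = refl
Φ-zero (suc d) = trans (ℕ.+-identityʳ _) (Φ-zero d)

Φ-pascal : ∀ d h → Φ (suc d) (suc h) ≡ Φ (suc d) h + Φ d h
Φ-pascal zero h = begin
  1 + (suc h) C 1    ≡⟨ cong (1 +_) (nC1≡n (suc h)) ⟩
  1 + suc h          ≡⟨ ℕ.+-comm 1 (suc h) ⟩
  suc h + 1          ≡⟨ cong (λ n → suc n + 1) (nC1≡n h) ⟨
  (1 + h C 1) + 1    ∎
  where open ≡-Reasoning
Φ-pascal (suc d) h = begin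
  Φ (suc d) (suc h) + (suc h) C suc (suc d)
    ≡⟨ cong₂ _+_ (Φ-pascal d h) (sym (nCk+nC[k+1]≡[n+1]C[k+1] h (suc d))) ⟩
  (Φ (suc d) h + Φ d h) + (h C suc d + h C suc (suc d))
    ≡⟨ regroup (Φ (suc d) h) (Φ d h) (h C suc d) (h C suc (suc d)) ⟩
  (Φ (suc d) h + h C suc (suc d)) + (Φ d h + h C suc d) ∎
  where
    open ≡-Reasoning
    regroup : ∀ a b c e → (a + b) + (c + e) ≡ (a + e) + (b + c)
    regroup = solve-∀

opaque
  Φ-join : ∀ d h → Fin (Φ (suc d) h) ⊎ Fin (Φ d h) → Fin (Φ (suc d) (suc h))
  Φ-join d h = subst Fin (sym (Φ-pascal d h)) ∘ join _ _

  Φ-join-injective : ∀ d h {x y} → Φ-join d h x ≡ Φ-join d h y → x ≡ y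
  Φ-join-injective d h {x} {y} eq = begin
    x                      ≡⟨ Fin.splitAt-join _ _ x ⟨
    splitAt _ (join _ _ x) ≡⟨ cong (splitAt _) (subst-injective (sym (Φ-pascal d h)) eq) ⟩
    splitAt _ (join _ _ y) ≡⟨ Fin.splitAt-join _ _ y ⟩
    y                      ∎
    where open ≡-Reasoning

-- Reading the word from the left, a letter matching the head of the pattern
-- leaves the tail to be avoided; this is Pascal's rule for Φ.
avoider-index : ∀ d (p : Vec Bool (suc d)) (w : Vec Bool h) → ¬ p ≼ w → Fin (Φ d h)
avoider-index d p [] _ = subst Fin (sym (Φ-zero d)) fzero
avoider-index d (x ∷ p) (b ∷ w) p⋠bw with b Bool.≟ x
avoider-index zero    (x ∷ []) (x ∷ w) p⋠xw | yes refl = ⊥-elim (p⋠xw (head-≼ x w))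
avoider-index (suc d) (x ∷ p)  (x ∷ w) p⋠xw | yes refl =
  Φ-join d _ (inj₂ (avoider-index d p w (p⋠xw ∘ ≼-keep)))
avoider-index zero    (x ∷ p)  (b ∷ w) p⋠bw | no _ = avoider-index zero (x ∷ p) w (p⋠bw ∘ ≼-skip)
avoider-index (suc d) (x ∷ p)  (b ∷ w) p⋠bw | no _ =
  Φ-join d _ (inj₁ (avoider-index (suc d) (x ∷ p) w (p⋠bw ∘ ≼-skip)))

≢-same : {b b′ x : Bool} → b ≢ x → b′ ≢ x → b ≡ b′
≢-same b≢x b′≢x = trans (Bool.¬-not b≢x) (sym (Bool.¬-not b′≢x))

avoider-index-injective : ∀ d (p : Vec Bool (suc d)) (w w′ : Vec Bool h) p⋠w p⋠w′ →
  avoider-index d p w p⋠w ≡ avoider-index d p w′ p⋠w′ → w ≡ w′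
avoider-index-injective d p [] [] _ _ _ = refl
avoider-index-injective d (x ∷ p) (b ∷ w) (b′ ∷ w′) p⋠ p⋠′ eq with b Bool.≟ x | b′ Bool.≟ x
avoider-index-injective zero (x ∷ []) (x ∷ w) _ p⋠ _ _ | yes refl | _ = ⊥-elim (p⋠ (head-≼ x w))
avoider-index-injective zero (x ∷ []) _ (x ∷ w′) _ p⋠′ _ | no _ | yes refl = ⊥-elim (p⋠′ (head-≼ x w′))
avoider-index-injective zero (x ∷ p) (b ∷ w) (b′ ∷ w′) _ _ eq | no b≢x | no b′≢x =
  cong₂ _∷_ (≢-same b≢x b′≢x) (avoider-index-injective zero (x ∷ p) w w′ _ _ eq)
avoider-index-injective (suc d) (x ∷ p) (x ∷ w) (x ∷ w′) _ _ eq | yes refl | yes refl =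
  cong (x ∷_) (avoider-index-injective d p w w′ _ _ (inj₂-injective (Φ-join-injective d _ eq)))
avoider-index-injective (suc d) (x ∷ p) _ _ _ _ eq | yes refl | no _ with () ← Φ-join-injective d _ eq
avoider-index-injective (suc d) (x ∷ p) _ _ _ _ eq | no _ | yes refl with () ← Φ-join-injective d _ eq
avoider-index-injective (suc d) (x ∷ p) (b ∷ w) (b′ ∷ w′) _ _ eq | no b≢x | no b′≢x =
  cong₂ _∷_ (≢-same b≢x b′≢x)
    (avoider-index-injective (suc d) (x ∷ p) w w′ _ _ (inj₁-injective (Φ-join-injective d _ eq)))

avoiders-bound : ∀ d (p : Vec Bool (suc d)) {N} (ws : Fin N → Vec Bool h) →
  (∀ i j → ws i ≡ ws j → i ≡ j) → (∀ i → ¬ p ≼ ws i) → N ≤ Φ d h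
avoiders-bound d p ws ws-injective avoid = Fin.injective⇒≤
  λ {i} {j} eq → ws-injective i j (avoider-index-injective d p (ws i) (ws j) (avoid i) (avoid j) eq)

replicate⊎switch : ∀ x (w : Vec Bool n) → x ∷ w ≡ replicate (suc n) x ⊎ x ∷ not x ∷ [] ≼ x ∷ w
replicate⊎switch x [] = inj₁ refl
replicate⊎switch x (y ∷ w) with y Bool.≟ x
... | no y≢x = inj₂ (keep (single fzero) ,
  cong (x ∷_) (trans (select-single fzero (y ∷ w)) (cong (_∷ []) (Bool.¬-not y≢x))))
... | yes refl with replicate⊎switch x w
...   | inj₁ eq = inj₁ (cong (x ∷_) eq)
...   | inj₂ sw = inj₂ (≼-skip sw)

switch-of-nonconstant : (w : Vec Bool (suc n)) → w ≢ replicate _ true → w ≢ replicate _ false →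
  true ∷ false ∷ [] ≼ w ⊎ false ∷ true ∷ [] ≼ w
switch-of-nonconstant (x ∷ w) ≢true ≢false with x | replicate⊎switch x w
... | true  | inj₁ eq = ⊥-elim (≢true eq)
... | false | inj₁ eq = ⊥-elim (≢false eq)
... | true  | inj₂ sw = inj₁ sw
... | false | inj₂ sw = inj₂ sw

pair-≼ : {u v : A} (w : Vec A n) → u ∷ v ∷ [] ≼ w →
  ∃[ j ] ∃[ j′ ] j <ᶠ j′ × lookup w j ≡ u × lookup w j′ ≡ v
pair-≼ w (θ , eq) =
  embed θ fzero , embed θ (fsuc fzero) , embed-mono-< θ (s≤s z≤n) ,
  trans (sym (lookup-select θ w fzero)) (cong (λ u → lookup u fzero) eq) ,
  trans (sym (lookup-select θ w (fsuc fzero))) (cong (λ u → lookup u (fsuc fzero)) eq)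

threshold : (Fin h → Fin n) → Fin n → Vec Bool h
threshold σ i = tabulate λ j → does (i Fin.<? σ j)

lookup-threshold : (σ : Fin h → Fin n) (i : Fin n) (j : Fin h) →
  lookup (threshold σ i) j ≡ true ⇔ i <ᶠ σ j
lookup-threshold σ i j =
  subst (λ b → b ≡ true ⇔ i <ᶠ σ j) (sym (lookup∘tabulate _ j)) (does≡true⇔ (i Fin.<? σ j))

threshold-avoids-10 : (σ : Fin h → Fin n) → (∀ {j j′} → j <ᶠ j′ → σ j <ᶠ σ j′) →
  ∀ i → ¬ true ∷ false ∷ [] ≼ threshold σ i
threshold-avoids-10 σ mono i sw
  with j , j′ , j<j′ , tj , fj′ ← pair-≼ (threshold σ i) sw
  with () ← trans (sym fj′) (from (lookup-threshold σ i j′)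
                              (Fin.<-trans (to (lookup-threshold σ i j) tj) (mono j<j′)))

threshold-avoids-01 : (σ : Fin h → Fin n) → (∀ {j j′} → j <ᶠ j′ → σ j′ <ᶠ σ j) →
  ∀ i → ¬ false ∷ true ∷ [] ≼ threshold σ i
threshold-avoids-01 σ anti i sw
  with j , j′ , j<j′ , fj , tj′ ← pair-≼ (threshold σ i) sw
  with () ← trans (sym fj) (from (lookup-threshold σ i j)
                             (Fin.<-trans (to (lookup-threshold σ i j′) tj′) (anti j<j′)))

opposite-antitone : {j j′ : Fin n} → j <ᶠ j′ → opposite j′ <ᶠ opposite j
opposite-antitone {n} {j} {j′} j<j′ = subst₂ _<_ (sym (Fin.opposite-prop j′)) (sym (Fin.opposite-prop j))
  (ℕ.∸-monoʳ-< (s≤s j<j′) (Fin.toℕ<n j′))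

-- Traces of a partitioned formula

module _ {L : Signature} (M : Structure L) (k m : ℕ) (φ : Formula L (k + m)) where

  private
    Param Point : Set
    Param = Vec (Carrier M) k
    Point = Vec (Carrier M) m

    _⊨_ : Param → Point → Set
    _⊨_ = holds M k m φ

    Trace : Vec Point t → Vec Bool t → Set
    Trace = InTrace M k m φ

  Ladder : ℕ → Set
  Ladder N = Σ (Fin N → Param) λ as → Σ (Fin N → Point) λ bs → ∀ i j → as i ⊨ bs j ⇔ (i <ᶠ j)

  Ladder-≤ : {N N′ : ℕ} → N ≤ N′ → Ladder N′ → Ladder N
  Ladder-≤ N≤N′ (as , bs , ladder) = as ∘ inject , bs ∘ inject , λ i j →
    subst₂ (λ x y → as (inject i) ⊨ bs (inject j) ⇔ (x < y))
      (Fin.toℕ-inject≤ i N≤N′) (Fin.toℕ-inject≤ j N≤N′) (ladder (inject i) (inject j))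
    where
      inject = λ i → inject≤ i N≤N′

  ladder-points-injective : ((as , bs , _) : Ladder N) → ∀ i j → bs i ≡ bs j → i ≡ j
  ladder-points-injective (as , bs , as⊨bs⇔<) i j eq with Fin.<-cmp i j
  ... | tri< i<j _ _ = ⊥-elim (Fin.<-irrefl refl
          (to (as⊨bs⇔< i i) (subst (as i ⊨_) (sym eq) (from (as⊨bs⇔< i j) i<j))))
  ... | tri≈ _ i≡j _ = i≡j
  ... | tri> _ _ j<i = ⊥-elim (Fin.<-irrefl refl
          (to (as⊨bs⇔< j j) (subst (as j ⊨_) eq (from (as⊨bs⇔< j i) j<i))))

  Distinct-select : (θ : r ⊑ t) (Y : Vec Point t) → Distinct M k m φ Y → Distinct M k m φ (select θ Y)
  Distinct-select θ Y distinct i j eq = embed-injective θ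
    (distinct _ _ (trans (sym (lookup-select θ Y i)) (trans eq (lookup-select θ Y j))))

  InTrace-select : (θ : r ⊑ t) (Y : Vec Point t) (s : Vec Bool t) →
    Trace Y s → Trace (select θ Y) (select θ s)
  InTrace-select θ Y s (a , a⊨Y⇔s) = a , λ i →
    subst₂ (λ b x → a ⊨ b ⇔ (x ≡ true)) (sym (lookup-select θ Y i)) (sym (lookup-select θ s i))
      (a⊨Y⇔s (embed θ i))

  InTrace-replicate : (Y : Vec Point t) (a : Param) (x : Bool) →
    (∀ i → a ⊨ lookup Y i ⇔ (x ≡ true)) → Trace Y (replicate t x)
  InTrace-replicate Y a x a⊨Y⇔x = a , λ i →
    subst (λ y → a ⊨ lookup Y i ⇔ (y ≡ true)) (sym (lookup-replicate i x)) (a⊨Y⇔x i)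

  trace-avoids : (Z : Vec Point h) (p : Vec Bool r) → (∀ (θ : r ⊑ h) → ¬ Trace (select θ Z) p) →
    ∀ s → Trace Z s → ¬ p ≼ s
  trace-avoids Z p missing s trace (θ , refl) = missing θ (InTrace-select θ Z s trace)

  ladder-from-thresholds : (Z : Vec Point h) (σ : Fin h → Fin h) → (∀ j → σ (σ j) ≡ j) →
    (∀ i → Trace Z (threshold σ i)) → Ladder h
  ladder-from-thresholds Z σ involutive traces = proj₁ ∘ traces , lookup Z ∘ σ , λ i j →
    subst (λ l → proj₁ (traces i) ⊨ lookup Z (σ j) ⇔ (i <ᶠ l)) (involutive j)
      (⇔.trans (proj₂ (traces i) (σ j)) (lookup-threshold σ i (σ j)))

  ladder-from-switch : (Z : Vec Point h) (p : Vec Bool r) → (∀ s → ¬ p ≼ s → Trace Z s) →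
    true ∷ false ∷ [] ≼ p ⊎ false ∷ true ∷ [] ≼ p → Ladder h
  ladder-from-switch Z p avoiders (inj₁ 10≼p) =
    ladder-from-thresholds Z id (λ _ → refl) λ i →
      avoiders _ (threshold-avoids-10 id id i ∘ ≼-trans 10≼p)
  ladder-from-switch Z p avoiders (inj₂ 01≼p) =
    ladder-from-thresholds Z opposite Fin.opposite-involutive λ i →
      avoiders _ (threshold-avoids-01 opposite opposite-antitone i ∘ ≼-trans 01≼p)

  module _ (lem : ExcludedMiddle 0ℓ) where

    missing-pattern : (Y : Vec Point t) → ¬ Shatters M k m φ Y → ∃[ s ] ¬ Trace Y s
    missing-pattern Y ¬shatters with lem {∃[ s ] ¬ Trace Y s}
    ... | yes missing = missing
    ... | no ¬missing = ⊥-elim (¬shatters λ s → decidable-stable lem λ ¬trace → ¬missing (s , ¬trace))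

    -- Ramsey's theorem, colouring each (d+1)-subset by the pattern it misses.
    uniform-missing-pattern : (∀ (Y : Vec Point (suc d)) → Distinct M k m φ Y → ¬ Shatters M k m φ Y) →
      ∀ h → suc d ≤ h → ∃[ T ] ∀ (Y : Vec Point T) → Distinct M k m φ Y →
        ∃[ p ] Σ (h ⊑ T) λ ψ → ∀ (θ : suc d ⊑ h) → ¬ Trace (select θ (select ψ Y)) p
    uniform-missing-pattern {d} vc h d<h with T , arrows ← ramsey (suc d) (const h) = T , λ Y distinct →
      let missing : (θ : suc d ⊑ T) → ∃[ s ] ¬ Trace (select θ Y) s
          missing θ = missing-pattern (select θ Y) (vc (select θ Y) (Distinct-select θ Y distinct))
          c , ψ , homogeneous = arrows (bits ∘ proj₁ ∘ missing)
          θ₀ = ≤⇒⊑ d<h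
          same : ∀ θ → proj₁ (missing (θ ⨾ ψ)) ≡ proj₁ (missing (θ₀ ⨾ ψ))
          same θ = bits-injective _ _ (trans (homogeneous θ) (sym (homogeneous θ₀)))
      in proj₁ (missing (θ₀ ⨾ ψ)) , ψ , λ θ →
           subst₂ (λ Z p → ¬ Trace Z p) (select-⨾ θ ψ Y) (same θ) (proj₂ (missing (θ ⨾ ψ)))

    -- The Φ d h traces of Z together with a further avoider of p would be too many.
    avoiders-are-traces : (Z : Vec Point h) → TraceCount M k m φ Z (Φ d h) →
      (p : Vec Bool (suc d)) → (∀ θ → ¬ Trace (select θ Z) p) → ∀ s → ¬ p ≼ s → Trace Z s
    avoiders-are-traces {h} {d} Z (ss , ss-distinct , ss-traces , _) p missing s p⋠s with lem {Trace Z s}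
    ... | yes trace = trace
    ... | no ¬trace = ⊥-elim (ℕ.1+n≰n (avoiders-bound d p words words-distinct avoid))
      where
        words : Fin (suc (Φ d h)) → Vec Bool h
        words fzero    = s
        words (fsuc i) = lookup ss i

        words-distinct : ∀ i j → words i ≡ words j → i ≡ j
        words-distinct fzero    fzero    _  = refl
        words-distinct fzero    (fsuc j) eq = ⊥-elim (¬trace (subst (Trace Z) (sym eq) (ss-traces j)))
        words-distinct (fsuc i) fzero    eq = ⊥-elim (¬trace (subst (Trace Z) eq (ss-traces i)))
        words-distinct (fsuc i) (fsuc j) eq = cong fsuc (ss-distinct i j eq)

        avoid : ∀ i → ¬ p ≼ words i
        avoid fzero    = p⋠s
        avoid (fsuc i) = trace-avoids Z p missing (lookup ss i) (ss-traces i)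

    one-sided-sets-bounded : DStarMaximum M k m φ d → ¬ Ladder N →
      ∃[ T ] ∀ (Y : Vec Point T) → Distinct M k m φ Y → (α β : Param) →
        (∀ i → α ⊨ lookup Y i) → (∀ i → ¬ β ⊨ lookup Y i) → ⊥
    one-sided-sets-bounded {d} {N} ((_ , vc) , count) no-ladder
      with T , uniform ← uniform-missing-pattern vc (N + suc d) (ℕ.m≤n+m (suc d) N)
      = T , λ Y distinct α β α⊨Y β⊭Y →
        let p , ψ , missing = uniform Y distinct
            Z = select ψ Y
            θ₀ = ≤⇒⊑ (ℕ.m≤n+m (suc d) N)
            not-constant : ∀ a x → (∀ i → a ⊨ lookup Z i ⇔ (x ≡ true)) → p ≢ replicate _ x
            not-constant a x a⊨Z⇔x p≡x = missing θ₀ (subst (Trace (select θ₀ Z)) (sym p≡x)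
              (InTrace-replicate (select θ₀ Z) a x
                (∀-select (λ b → a ⊨ b ⇔ (x ≡ true)) θ₀ Z a⊨Z⇔x)))
            switch = switch-of-nonconstant p
              (not-constant α true λ i → mk⇔ (const refl) (const (∀-select (α ⊨_) ψ Y α⊨Y i)))
              (not-constant β false λ i → mk⇔ (⊥-elim ∘ ∀-select (¬_ ∘ (β ⊨_)) ψ Y β⊭Y i) λ ())
            avoiders = avoiders-are-traces Z (count _ Z (Distinct-select ψ Y distinct)) p missing
        in no-ladder (Ladder-≤ (ℕ.m≤m+n N (suc d)) (ladder-from-switch Z p avoiders switch))

    symmetric-differences-bounded : DStarMaximum M k m φ d → ¬ Ladder N →
      ∃[ n ] ∀ (a′ a : Param) (Y : Vec Point n) → Distinct M k m φ Y →
        ¬ (∀ i → _xor_ M k m φ (a ⊨ lookup Y i) (a′ ⊨ lookup Y i))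
    symmetric-differences-bounded dmax no-ladder =
      let T , one-sided = one-sided-sets-bounded dmax no-ladder
          n , split = monochromatic-subsequence {A = Point} T
      in n , λ a′ a Y distinct in-symdiff →
        let ψ , side = split {P = a ⊨_} (λ _ → lem) Y
            Z = select ψ Y
            Z-distinct = Distinct-select ψ Y distinct
            in-symdiff-Z = ∀-select (λ b → _xor_ M k m φ (a ⊨ b) (a′ ⊨ b)) ψ Y in-symdiff
        in [ (λ a⊨Z → one-sided Z Z-distinct a a′ a⊨Z (λ i → xor⇒¬ (in-symdiff-Z i) (a⊨Z i)))
           , (λ a⊭Z → one-sided Z Z-distinct a′ a (λ i → xor⇒ (in-symdiff-Z i) (a⊭Z i)) a⊭Z)
           ]′ side

    listed-or-many : (S : Point → Set) → ∀ n →
      (∃[ F ] length F ≤ n × ∀ b → b ∈ F ⇔ S b) ⊎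
      (Σ (Vec Point n) λ Y → Distinct M k m φ Y × ∀ i → S (lookup Y i))
    listed-or-many S zero = inj₂ ([] , (λ ()) , λ ())
    listed-or-many S (suc n) with listed-or-many S n
    ... | inj₁ (F , |F|≤n , F⇔S) = inj₁ (F , ℕ.m≤n⇒m≤1+n |F|≤n , F⇔S)
    ... | inj₂ (Y , distinct , S-Y) with lem {∃[ b ] S b × ¬ b ∈ toList Y}
    ...   | yes (b , Sb , b∉Y) = inj₂ (b ∷ Y , distinct′ , λ { fzero → Sb ; (fsuc i) → S-Y i })
      where
        b≢Y : ∀ i → b ≢ lookup Y i
        b≢Y i eq = b∉Y (subst (_∈ toList Y) (sym eq) (∈-toList⁺ (∈-lookup i Y)))

        distinct′ : Distinct M k m φ (b ∷ Y)
        distinct′ fzero    fzero    _  = refl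
        distinct′ fzero    (fsuc j) eq = ⊥-elim (b≢Y j eq)
        distinct′ (fsuc i) fzero    eq = ⊥-elim (b≢Y i (sym eq))
        distinct′ (fsuc i) (fsuc j) eq = cong fsuc (distinct i j eq)
    ...   | no ¬new =
      inj₁ (toList Y , ℕ.≤-trans (ℕ.≤-reflexive (length-toList Y)) (ℕ.n≤1+n n) , λ b → mk⇔ (Y⇒S b) (S⇒Y b))
      where
        Y⇒S : ∀ b → b ∈ toList Y → S b
        Y⇒S b b∈Y = let b∈ = ∈-toList⁻ b∈Y in
          subst S (sym (VecAny.lookup-index b∈)) (S-Y (VecAny.index b∈))

        S⇒Y : ∀ b → S b → b ∈ toList Y
        S⇒Y b Sb = decidable-stable lem λ b∉Y → ¬new (b , Sb , b∉Y)

    stable⇒boundedΔ : DStarMaximum M k m φ d → Stable M k m φ → ∃[ n ] BoundedΔ M k m φ n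
    stable⇒boundedΔ dmax (N , no-ladder) =
      let n , small = symmetric-differences-bounded dmax no-ladder
      in n , λ a′ a → [ (λ (F , |F|≤n , F⇔) → F , |F|≤n , λ b → xor-swap lem lem (F⇔ b))
                      , (λ (Y , distinct , in-symdiff) → ⊥-elim (small a′ a Y distinct in-symdiff))
                      ]′ (listed-or-many (λ b → _xor_ M k m φ (a ⊨ b) (a′ ⊨ b)) n)

    boundedΔ⇒stable : BoundedΔ M k m φ n → Stable M k m φ
    boundedΔ⇒stable {n} bounded = suc (suc n) , λ ladder@(as , bs , as⊨bs⇔<) →
      let F , |F|≤n , F⇔ = bounded (as fzero) (as (fromℕ (suc n)))
          in-F : ∀ j → bs (fsuc j) ∈ F
          in-F j = decidable-stable lem λ ∉F → ℕ.≤⇒≯ (Fin.≤fromℕ (fsuc j))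
            (to (as⊨bs⇔< _ (fsuc j)) (from (F⇔ (bs (fsuc j)))
              (inj₂ (∉F , from (as⊨bs⇔< fzero (fsuc j)) (s≤s z≤n)))))
      in ℕ.1+n≰n (ℕ.≤-trans (injective-members⇒≤-length (bs ∘ fsuc) F
           (λ i j → Fin.suc-injective ∘ ladder-points-injective ladder (fsuc i) (fsuc j)) in-F) |F|≤n)

theorem2p16 : ExcludedMiddle 0ℓ →
    (L : Signature) (T : Theory L) → Complete T →
    (𝕄 : Structure L) → Monster T 𝕄 →
    (k m : ℕ) (φ : Formula L (k + m)) (d : ℕ) → DStarMaximum 𝕄 k m φ d →
    (Stable 𝕄 k m φ ⇔ (∃[ n ] BoundedΔ 𝕄 k m φ n))
theorem2p16 lem _ _ _ 𝕄 _ k m φ _ dmax =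
  mk⇔ (stable⇒boundedΔ 𝕄 k m φ lem dmax) (boundedΔ⇒stable 𝕄 k m φ lem ∘ proj₂)
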